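{- Let $G$ be a finite $p$-group and let $g\in G$ have order $p$. Then the connected component of $\mathcal{G}^*(G)$ containing $g$ equals $\Gamma(g)$.
   Context: $p$ is a prime; a $p$-group is a group of order at least two in which every element has order a power of $p$. The power graph $\mathcal{G}(G)$ has vertex set $G$, distinct $u,v$ adjacent iff one is a positive power of the other. $\mathcal{G}^*(G)$ is the subgraph of $\mathcal{G}(G)$ induced by $G\setminus\{e\}$. For $g\in G$, $U(g)=\{h\in G: g\in\langle h\rangle\}$ and $\Gamma(g)$ is the subgraph of $\mathcal{G}(G)$ induced by $U(g)$. -}

module Defs where

open import Level using (Level; 0ℓ)
open import Algebra.Bundles using (Group)
open import Data.Nat using (ℕ; zero; suc; _≤_; _<_; _^_)
open import Data.Integer using (ℤ; +_; -[1+_])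
open import Data.Fin using (Fin)
open import Data.Product using (Σ; ∃; _×_)
open import Data.Nat.Primality using (Prime)
open import Relation.Nullary using (¬_)
open import Function.Bundles using (Bijection)
import Relation.Binary.PropositionalEquality as ≡

module _ {c ℓ : Level} (G : Group c ℓ) where
  open Group G

  pow : Carrier → ℕ → Carrier
  pow x zero    = ε
  pow x (suc k) = x ∙ pow x k

  zpow : Carrier → ℤ → Carrier
  zpow x (+ k)      = pow x k
  zpow x -[1+ k ]   = (pow x (suc k)) ⁻¹

  HasCardinality : ℕ → Set _
  HasCardinality n = Bijection setoid (≡.setoid (Fin n))

  IsOrder : Carrier → ℕ → Set _
  IsOrder x k = (1 ≤ k) × (pow x k ≈ ε) × (∀ j → 1 ≤ j → j < k → ¬ (pow x j ≈ ε))

  IsFinitePGroup : ℕ → Set _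
  IsFinitePGroup p = Σ ℕ (λ n → HasCardinality n × (2 ≤ n))
                   × (∀ x → ∃ λ m → IsOrder x (p ^ m))

  _∈⟨_⟩ : Carrier → Carrier → Set _
  g ∈⟨ h ⟩ = ∃ λ (z : ℤ) → g ≈ zpow h z

  Adj : Carrier → Carrier → Set _
  Adj u v = ¬ (u ≈ v) × ((∃ λ k → (1 ≤ k) × (v ≈ pow u k)) Data.Sum.⊎ (∃ λ k → (1 ≤ k) × (u ≈ pow v k)))
    where import Data.Sum

  Adj* : Carrier → Carrier → Set _
  Adj* u v = ¬ (u ≈ ε) × ¬ (v ≈ ε) × Adj u v

  data Walk* : Carrier → Carrier → Set (c Level.⊔ ℓ) where
    stay : ∀ {x y} → x ≈ y → Walk* x y
    step : ∀ {x y z} → Adj* x y → Walk* y z → Walk* x z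

-- Along a walk in 𝒢*(G) from g, every vertex x keeps g ∈ ⟨x⟩. Stepping to a root x = yᵏ
-- preserves this trivially. Stepping to a nontrivial power y = xᵏ preserves it because ⟨x⟩ is
-- cyclic of order pᵐ and g, of order p, lies in every nontrivial subgroup of ⟨x⟩: from
-- pᵐ ∤ k we get gcd(k, pᵐ) ∣ pᵐ⁻¹, and pᵐ⁻¹ divides the exponent a of g = xᵃ, so
-- k t ≡ a (mod pᵐ) is solvable and g = yᵗ. Conversely, if g ∈ ⟨h⟩ then h ≠ e and h is
-- either g itself or adjacent to g.
module Submission where

open import Defs
open import Level using (Level)
open import Algebra.Bundles using (Group)
open import Data.Nat
open import Data.Nat.Properties using (*-comm; *-assoc; m^n≢0)
open import Data.Nat.Divisibility
open import Data.Nat.DivMod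
open import Data.Nat.Primality using (Prime; prime⇒irreducible; prime⇒nonZero; prime⇒nonTrivial)
open import Data.Nat.Coprimality using (Coprime; coprime-divisor)
open import Data.Nat.GCD using (gcd; gcd-GCD; gcd[m,n]∣m; gcd[m,n]∣n; module Bézout)
open import Data.Nat.Tactic.RingSolver using (solve-∀)
import Data.Integer as ℤ
open import Data.Product using (∃; _×_; _,_; proj₁; proj₂)
open import Data.Sum using (_⊎_; inj₁; inj₂; [_,_]′)
open import Data.Empty using (⊥-elim)
import Data.Fin as Fin
open import Relation.Nullary using (¬_; yes; no)
open import Relation.Nullary.Decidable using (map′)
open import Relation.Binary.Definitions using (Decidable)
open import Relation.Binary.PropositionalEquality as ≡ using (_≡_; cong; subst; module ≡-Reasoning)
open import Function.Bundles using (Bijection; _⇔_; mk⇔)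

prime∤⇒coprime : ∀ {p d} → Prime p → ¬ p ∣ d → Coprime d p
prime∤⇒coprime pp p∤d (i∣d , i∣p) with prime⇒irreducible pp i∣p
... | inj₁ i≡1 = i≡1
... | inj₂ ≡.refl = ⊥-elim (p∤d i∣d)

∣p^[1+m]⇒∣p^m⊎p^[1+m]∣ : ∀ {p} → Prime p → ∀ m {d} → d ∣ p ^ suc m → d ∣ p ^ m ⊎ p ^ suc m ∣ d
∣p^[1+m]⇒∣p^m⊎p^[1+m]∣ {p} pp m {d} d∣ with p ∣? d
... | no p∤d = inj₁ (coprime-divisor (prime∤⇒coprime pp p∤d) d∣)
... | yes (divides e ≡.refl) = multiply m (*-cancelʳ-∣ p (subst (e * p ∣_) (*-comm p (p ^ m)) d∣))
  where
  instance _ = prime⇒nonZero pp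
  multiply : ∀ m → e ∣ p ^ m → e * p ∣ p ^ m ⊎ p ^ suc m ∣ e * p
  multiply zero e∣1 rewrite ∣1⇒≡1 e∣1 = inj₂ (∣-reflexive (*-comm p 1))
  multiply (suc m) e∣ = [ (λ e∣p^m → inj₁ (subst (e * p ∣_) (*-comm (p ^ m) p) (*-monoˡ-∣ p e∣p^m)))
                        , (λ p^[1+m]∣e → inj₂ (subst (_∣ e * p) (*-comm (p ^ suc m) p) (*-monoˡ-∣ p p^[1+m]∣e)))
                        ]′ (∣p^[1+m]⇒∣p^m⊎p^[1+m]∣ pp m e∣)

gcd[k,p^m]∣a : ∀ {p} → Prime p → ∀ m {a k} → p ^ m ∣ a * p → ¬ p ^ m ∣ k → gcd k (p ^ m) ∣ a
gcd[k,p^m]∣a pp zero {a} {k} _ _ = ∣-trans (gcd[m,n]∣n k 1) (1∣ a)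
gcd[k,p^m]∣a {p} pp (suc m) {a} {k} p^[1+m]∣ap p^[1+m]∤k =
  [ (λ gcd∣p^m → ∣-trans gcd∣p^m p^m∣a)
  , (λ p^[1+m]∣gcd → ⊥-elim (p^[1+m]∤k (∣-trans p^[1+m]∣gcd (gcd[m,n]∣m k (p ^ suc m)))))
  ]′ (∣p^[1+m]⇒∣p^m⊎p^[1+m]∣ pp m (gcd[m,n]∣n k (p ^ suc m)))
  where
  instance _ = prime⇒nonZero pp
  p^m∣a : p ^ m ∣ a
  p^m∣a = *-cancelˡ-∣ p (subst (p ^ suc m ∣_) (*-comm a p) p^[1+m]∣ap)

bézout⇒k*x≡d-mod : ∀ {d k n} .{{_ : NonZero n}} → Bézout.Identity d k n → ∃ λ x → k * x % n ≡ d % n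
bézout⇒k*x≡d-mod {d} {k} {n} (Bézout.+- x y d+yn≡xk) = x , (begin
  k * x % n       ≡⟨ cong (_% n) (≡.trans (*-comm k x) (≡.sym d+yn≡xk)) ⟩
  (d + y * n) % n ≡⟨ [m+kn]%n≡m%n d y n ⟩
  d % n           ∎)
  where open ≡-Reasoning
-- Here x k ≡ -d, so (n - 1) x k ≡ d (mod n).
bézout⇒k*x≡d-mod {d} {k} {n@(suc n-1)} (Bézout.-+ x y d+xk≡yn) = n-1 * x , (begin
  k * (n-1 * x) % n           ≡⟨ [m+kn]%n≡m%n (k * (n-1 * x)) d n ⟨
  (k * (n-1 * x) + d * n) % n ≡⟨ cong (_% n) shift ⟩
  (d + n-1 * y * n) % n       ≡⟨ [m+kn]%n≡m%n d (n-1 * y) n ⟩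
  d % n                       ∎)
  where
  open ≡-Reasoning
  shift : k * (n-1 * x) + d * n ≡ d + n-1 * y * n
  shift = begin
    k * (n-1 * x) + d * n ≡⟨ expand k x d n-1 ⟩
    d + n-1 * (d + x * k) ≡⟨ cong (λ m → d + n-1 * m) d+xk≡yn ⟩
    d + n-1 * (y * n)     ≡⟨ cong (d +_) (≡.sym (*-assoc n-1 y n)) ⟩
    d + n-1 * y * n       ∎
    where
    expand : ∀ k x d m → k * (m * x) + d * suc m ≡ d + m * (d + x * k)
    expand = solve-∀

linear-congruence : ∀ k n {a} .{{_ : NonZero n}} → gcd k n ∣ a → ∃ λ t → k * t % n ≡ a % n
linear-congruence k n (divides c ≡.refl)
  with x , kx≡d ← bézout⇒k*x≡d-mod {k = k} {n} (Bézout.identity (gcd-GCD k n)) = x * c , (begin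
    k * (x * c) % n               ≡⟨ cong (_% n) (≡.sym (*-assoc k x c)) ⟩
    k * x * c % n                 ≡⟨ %-distribˡ-* (k * x) c n ⟩
    (k * x % n) * (c % n) % n     ≡⟨ cong (λ r → r * (c % n) % n) kx≡d ⟩
    (gcd k n % n) * (c % n) % n   ≡⟨ %-distribˡ-* (gcd k n) c n ⟨
    gcd k n * c % n               ≡⟨ cong (_% n) (*-comm (gcd k n) c) ⟩
    c * gcd k n % n               ∎)
  where open ≡-Reasoning

module PowerGraph {c ℓ : Level} (G : Group c ℓ) where
  open Group G
  open import Algebra.Properties.Group G using (inverseʳ-unique)
  open import Algebra.Properties.Monoid.Mult monoid using (×-homo-+; ×-assocˡ; ×-congʳ; ×-congˡ)
    renaming (_×_ to _×ᴹ_)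
  open import Relation.Binary.Reasoning.Setoid setoid

  pow≡× : ∀ x n → pow G x n ≡ n ×ᴹ x
  pow≡× x zero    = ≡.refl
  pow≡× x (suc n) = cong (x ∙_) (pow≡× x n)

  pow-cong : ∀ {x y} n → x ≈ y → pow G x n ≈ pow G y n
  pow-cong {x} {y} n x≈y rewrite pow≡× x n | pow≡× y n = ×-congʳ n x≈y

  pow-+ : ∀ x m n → pow G x (m + n) ≈ pow G x m ∙ pow G x n
  pow-+ x m n rewrite pow≡× x (m + n) | pow≡× x m | pow≡× x n = ×-homo-+ x m n

  pow-* : ∀ x m n → pow G x (m * n) ≈ pow G (pow G x m) n
  pow-* x m n rewrite pow≡× x (m * n) | pow≡× x m | pow≡× (m ×ᴹ x) n =
    sym (trans (×-assocˡ x n m) (×-congˡ (*-comm n m)))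

  pow-ε : ∀ n → pow G ε n ≈ ε
  pow-ε n = sym (pow-* ε 0 n)

  pow-multiple≈ε : ∀ {x N} q → pow G x N ≈ ε → pow G x (N * q) ≈ ε
  pow-multiple≈ε {x} {N} q xᴺ≈ε = begin
    pow G x (N * q)       ≈⟨ pow-* x N q ⟩
    pow G (pow G x N) q   ≈⟨ pow-cong q xᴺ≈ε ⟩
    pow G ε q             ≈⟨ pow-ε q ⟩
    ε                     ∎

  pow-% : ∀ {x N} .{{_ : NonZero N}} s → pow G x N ≈ ε → pow G x s ≈ pow G x (s % N)
  pow-% {x} {N} s xᴺ≈ε = begin
    pow G x s                                   ≡⟨ cong (pow G x) (m≡m%n+[m/n]*n s N) ⟩
    pow G x (s % N + s / N * N)                 ≈⟨ pow-+ x (s % N) (s / N * N) ⟩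
    pow G x (s % N) ∙ pow G x (s / N * N)       ≈⟨ ∙-congˡ (reflexive (cong (pow G x) (*-comm (s / N) N))) ⟩
    pow G x (s % N) ∙ pow G x (N * (s / N))     ≈⟨ ∙-congˡ (pow-multiple≈ε {x} {N} (s / N) xᴺ≈ε) ⟩
    pow G x (s % N) ∙ ε                         ≈⟨ identityʳ _ ⟩
    pow G x (s % N)                             ∎

  order∣ : ∀ {x N s} → IsOrder G x N → pow G x s ≈ ε → N ∣ s
  order∣ {N = zero} (() , _)
  order∣ {x} {N@(suc _)} {s} (_ , xᴺ≈ε , minimal) xˢ≈ε with s % N in s%N≡r
  ... | zero  = m%n≡0⇒n∣m s N s%N≡r
  ... | suc r = ⊥-elim (minimal (suc r) (s≤s z≤n) (subst (_< N) s%N≡r (m%n<n s N)) (begin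
    pow G x (suc r)   ≡⟨ cong (pow G x) s%N≡r ⟨
    pow G x (s % N)   ≈⟨ pow-% s xᴺ≈ε ⟨
    pow G x s         ≈⟨ xˢ≈ε ⟩
    ε                 ∎))

  -- Membership in ⟨x⟩ via natural exponents only; it agrees with `_∈⟨_⟩` for x of finite order.
  infix 4 _∈⁺⟨_⟩
  _∈⁺⟨_⟩ : Carrier → Carrier → Set ℓ
  g ∈⁺⟨ x ⟩ = ∃ λ a → g ≈ pow G x a

  ∈⁺⟨⟩-refl : ∀ {x} → x ∈⁺⟨ x ⟩
  ∈⁺⟨⟩-refl {x} = 1 , sym (identityʳ x)

  ∈⁺⟨⟩-respʳ-≈ : ∀ {g x y} → x ≈ y → g ∈⁺⟨ x ⟩ → g ∈⁺⟨ y ⟩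
  ∈⁺⟨⟩-respʳ-≈ x≈y (a , g≈xᵃ) = a , trans g≈xᵃ (pow-cong a x≈y)

  ∈⁺⟨⟩-trans : ∀ {g x y} → g ∈⁺⟨ x ⟩ → x ∈⁺⟨ y ⟩ → g ∈⁺⟨ y ⟩
  ∈⁺⟨⟩-trans {y = y} (a , g≈xᵃ) (k , x≈yᵏ) =
    k * a , trans g≈xᵃ (trans (pow-cong a x≈yᵏ) (sym (pow-* y k a)))

  ∈⁺⟨⟩-nontrivial : ∀ {g x} → ¬ g ≈ ε → g ∈⁺⟨ x ⟩ → ¬ x ≈ ε
  ∈⁺⟨⟩-nontrivial g≉ε (a , g≈xᵃ) x≈ε = g≉ε (trans g≈xᵃ (trans (pow-cong a x≈ε) (pow-ε a)))

  ∈⟨⟩⇒∈⁺⟨⟩ : ∀ {g x N} → IsOrder G x N → _∈⟨_⟩ G g x → g ∈⁺⟨ x ⟩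
  ∈⟨⟩⇒∈⁺⟨⟩ _ (ℤ.+ a , g≈xᵃ) = a , g≈xᵃ
  ∈⟨⟩⇒∈⁺⟨⟩ {N = zero} (() , _)
  ∈⟨⟩⇒∈⁺⟨⟩ {g} {x} {suc n} (_ , xᴺ≈ε , _) (ℤ.-[1+ k ] , g≈x⁻ᵏ) =
    n * suc k , trans g≈x⁻ᵏ (sym inverse-as-power)
    where
    inverse-as-power : pow G x (n * suc k) ≈ pow G x (suc k) ⁻¹
    inverse-as-power = inverseʳ-unique (pow G x (suc k)) (pow G x (n * suc k)) (begin
      pow G x (suc k) ∙ pow G x (n * suc k) ≈⟨ pow-+ x (suc k) (n * suc k) ⟨
      pow G x (suc n * suc k)               ≈⟨ pow-multiple≈ε {x} {suc n} (suc k) xᴺ≈ε ⟩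
      ε                                     ∎)

  order>1⇒≉ε : ∀ {x N} → IsOrder G x N → 1 < N → ¬ x ≈ ε
  order>1⇒≉ε {x} (_ , _ , minimal) 1<N x≈ε = minimal 1 (s≤s z≤n) 1<N (trans (identityʳ x) x≈ε)

  p-torsion∈⁺⟨nontrivial-power⟩ : ∀ {p g x y} → Prime p → ∃ (λ m → IsOrder G x (p ^ m)) →
                                  pow G g p ≈ ε → g ∈⁺⟨ x ⟩ → y ∈⁺⟨ x ⟩ → ¬ y ≈ ε → g ∈⁺⟨ y ⟩
  p-torsion∈⁺⟨nontrivial-power⟩ {p} {g} {x} {y} pp (m , x-order@(_ , x^pᵐ≈ε , _)) gᵖ≈ε
                                (a , g≈xᵃ) (k , y≈xᵏ) y≉ε
    = power-of-y (linear-congruence k (p ^ m) (gcd[k,p^m]∣a pp m pᵐ∣ap pᵐ∤k))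
    where
    instance _ = m^n≢0 p m {{prime⇒nonZero pp}}
    pᵐ∣ap : p ^ m ∣ a * p
    pᵐ∣ap = order∣ x-order (trans (pow-* x a p) (trans (pow-cong p (sym g≈xᵃ)) gᵖ≈ε))
    pᵐ∤k : ¬ p ^ m ∣ k
    pᵐ∤k pᵐ∣k = y≉ε (begin
      y                   ≈⟨ y≈xᵏ ⟩
      pow G x k           ≈⟨ pow-% k x^pᵐ≈ε ⟩
      pow G x (k % p ^ m) ≡⟨ cong (pow G x) (n∣m⇒m%n≡0 k (p ^ m) pᵐ∣k) ⟩
      ε                   ∎)
    power-of-y : (∃ λ t → k * t % p ^ m ≡ a % p ^ m) → g ∈⁺⟨ y ⟩
    power-of-y (t , kt≡a) = t , (begin
      g                         ≈⟨ g≈xᵃ ⟩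
      pow G x a                 ≈⟨ pow-% a x^pᵐ≈ε ⟩
      pow G x (a % p ^ m)       ≡⟨ cong (pow G x) kt≡a ⟨
      pow G x (k * t % p ^ m)   ≈⟨ pow-% (k * t) x^pᵐ≈ε ⟨
      pow G x (k * t)           ≈⟨ pow-* x k t ⟩
      pow G (pow G x k) t       ≈⟨ pow-cong t y≈xᵏ ⟨
      pow G y t                 ∎)

  Walk*-preserves-∈⁺⟨⟩ : ∀ {p g x y} → Prime p → (∀ z → ∃ λ m → IsOrder G z (p ^ m)) →
                         pow G g p ≈ ε → Walk* G x y → g ∈⁺⟨ x ⟩ → g ∈⁺⟨ y ⟩
  Walk*-preserves-∈⁺⟨⟩ pp orders gᵖ≈ε (stay x≈y) g∈⁺⟨x⟩ = ∈⁺⟨⟩-respʳ-≈ x≈y g∈⁺⟨x⟩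
  Walk*-preserves-∈⁺⟨⟩ pp orders gᵖ≈ε (step {x} (_ , y≉ε , _ , inj₁ (k , _ , y≈xᵏ)) walk) g∈⁺⟨x⟩ =
    Walk*-preserves-∈⁺⟨⟩ pp orders gᵖ≈ε walk
      (p-torsion∈⁺⟨nontrivial-power⟩ pp (orders x) gᵖ≈ε g∈⁺⟨x⟩ (k , y≈xᵏ) y≉ε)
  Walk*-preserves-∈⁺⟨⟩ pp orders gᵖ≈ε (step (_ , _ , _ , inj₂ (k , _ , x≈yᵏ)) walk) g∈⁺⟨x⟩ =
    Walk*-preserves-∈⁺⟨⟩ pp orders gᵖ≈ε walk (∈⁺⟨⟩-trans g∈⁺⟨x⟩ (k , x≈yᵏ))

  ∈⁺⟨⟩⇒Walk* : Decidable _≈_ → ∀ {g h} → ¬ g ≈ ε → g ∈⁺⟨ h ⟩ → Walk* G g h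
  ∈⁺⟨⟩⇒Walk* _≟_ g≉ε (zero , g≈ε) = ⊥-elim (g≉ε g≈ε)
  ∈⁺⟨⟩⇒Walk* _≟_ {g} {h} g≉ε g∈⁺⟨h⟩@(suc a , g≈hᵃ) with g ≟ h
  ... | yes g≈h = stay g≈h
  ... | no g≉h  = step (g≉ε , ∈⁺⟨⟩-nontrivial g≉ε g∈⁺⟨h⟩ , g≉h , inj₂ (suc a , s≤s z≤n , g≈hᵃ)) (stay refl)

  hasCardinality⇒decidable : ∀ {n} → HasCardinality G n → Decidable _≈_
  hasCardinality⇒decidable |G|≡n x y = map′ (Bijection.injective |G|≡n) (Bijection.cong |G|≡n)
    (Bijection.to |G|≡n x Fin.≟ Bijection.to |G|≡n y)

lemma3p13 : ∀ {c ℓ : Level} (G : Group c ℓ) (p : ℕ) → Prime p → IsFinitePGroup G p →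
    (g : Group.Carrier G) → IsOrder G g p →
    ∀ (h : Group.Carrier G) →
      ((¬ (Group._≈_ G h (Group.ε G)) × Walk* G g h) ⇔ _∈⟨_⟩ G g h)
lemma3p13 G p pp ((_ , |G|≡n , _) , orders) g g-order h = mk⇔ walk⇒∈⟨⟩ ∈⟨⟩⇒walk
  where
  open Group G using (_≈_; ε)
  open PowerGraph G
  gᵖ≈ε : pow G g p ≈ ε
  gᵖ≈ε = proj₁ (proj₂ g-order)
  g≉ε : ¬ g ≈ ε
  g≉ε = order>1⇒≉ε g-order (nonTrivial⇒n>1 p {{prime⇒nonTrivial pp}})
  walk⇒∈⟨⟩ : ¬ h ≈ ε × Walk* G g h → _∈⟨_⟩ G g h
  walk⇒∈⟨⟩ (_ , walk) with a , g≈hᵃ ← Walk*-preserves-∈⁺⟨⟩ pp orders gᵖ≈ε walk ∈⁺⟨⟩-refl = ℤ.+ a , g≈hᵃ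
  ∈⟨⟩⇒walk : _∈⟨_⟩ G g h → ¬ h ≈ ε × Walk* G g h
  ∈⟨⟩⇒walk g∈⟨h⟩ = ∈⁺⟨⟩-nontrivial g≉ε g∈⁺⟨h⟩ , ∈⁺⟨⟩⇒Walk* (hasCardinality⇒decidable |G|≡n) g≉ε g∈⁺⟨h⟩
    where
    g∈⁺⟨h⟩ : g ∈⁺⟨ h ⟩
    g∈⁺⟨h⟩ = ∈⟨⟩⇒∈⁺⟨⟩ (proj₂ (orders h)) g∈⟨h⟩
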